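{- Let $r$ be a binary string of length $k$ ending in $0$, and let $n\ge 2$. If $1\notin K(r)$, then \[ f(r,n+1)=2f(r,n)+(n-k)\,\mathrm{UD}_n(r)+\mathrm{UD}_n(r_k^1)+\sum_{i\in K(r)}\left(f(r_{i-1}^-,n)+f(r_i^-,n)\right), \] and if $1\in K(r)$, then \[ f(r,n+1)=2f(r,n)+(n-k)\,\mathrm{UD}_n(r)+\mathrm{UD}_n(r_k^1)+f(r_1^-,n)+\sum_{i\in K(r),\ i\ne1}\left(f(r_{i-1}^-,n)+f(r_i^-,n)\right). \]
   Context: For $\pi=\pi_1\cdots\pi_m\in S_m$, its index is the binary string $r^\pi=r_1\cdots r_{m-1}$ with $r_i=0$ if $\pi_i<\pi_{i+1}$ and $r_i=1$ if $\pi_i>\pi_{i+1}$. For a binary string $r$, $\mathrm{UD}_m(r)$ is the number of $\pi\in S_m$ whose index is $r00\cdots0$ (i.e. $r$ followed only by zeros). For a binary string $r$ ending in $0$, $f(r,m)$ is the number of $\pi\in S_m$ whose index is $rr'$ for some binary string $r'$ containing exactly one $1$. For a binary string $r$, $r_\ell^-$ denotes $r$ with its $\ell$-th letter deleted, and $r_\ell^1$ denotes $r$ with its $\ell$-th letter replaced by $1$. A position $i$ is a peak of $r$ if $r_i=1$ and either $i=1$ or $r_{i-1}=0$; $K(r)$ is the set of peaks of $r$. -}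

module Defs where

open import Data.Bool using (Bool; true; false; not; _∧_; _∨_)
import Data.Bool as B
open import Data.Nat using (ℕ; zero; suc; _<ᵇ_; _≡ᵇ_; _∸_)
open import Data.Fin using (Fin; toℕ)
import Data.Fin as F
open import Data.List using (List; []; _∷_; _++_; length; map; filter; replicate; take; drop; concatMap; upTo; sum)
open import Data.List.Properties using (≡-dec)
open import Data.List.Relation.Unary.Unique.Propositional using (Unique)
import Data.List.Relation.Unary.Unique.DecPropositional as UDec
open import Relation.Binary.PropositionalEquality using (_≡_)
open import Relation.Nullary using (Dec)
open import Relation.Nullary.Decidable using (_×-dec_)
open import Data.Product using (_×_)
open import Data.Integer using (ℤ)
import Data.Integer as ℤ
import Data.List
import Data.Nat
import Data.Empty

-- Binary strings: lists of Bool, with true = 1 and false = 0.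
BinStr : Set
BinStr = List Bool

words : (m n : ℕ) → List (List (Fin m))
words m zero = [] ∷ []
words m (suc n) = concatMap (λ w → map (_∷ w) (Data.List.allFin m)) (words m n)

-- S_m: permutations of {0,…,m-1} in one-line notation
-- (words of length m over Fin m with pairwise distinct letters).
S : (m : ℕ) → List (List (Fin m))
S m = filter (λ w → UDec.unique? (F._≟_ {m}) w) (words m m)

index : ∀ {m} → List (Fin m) → BinStr
index [] = []
index (x ∷ []) = []
index (x ∷ y ∷ rest) = (toℕ y <ᵇ toℕ x) ∷ index (y ∷ rest)

IsUD : BinStr → BinStr → Set
IsUD r idx = idx ≡ r ++ replicate (length idx ∸ length r) false

isUD? : (r idx : BinStr) → Dec (IsUD r idx)
isUD? r idx = ≡-dec B._≟_ idx (r ++ replicate (length idx ∸ length r) false)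

UD : ℕ → BinStr → ℕ
UD m r = length (filter (λ π → isUD? r (index π)) (S m))

numOnes : BinStr → ℕ
numOnes w = length (filter (λ b → b B.≟ true) w)

IsF : BinStr → BinStr → Set
IsF r idx = (r ++ drop (length r) idx ≡ idx) × (numOnes (drop (length r) idx) ≡ 1)

isF? : (r idx : BinStr) → Dec (IsF r idx)
isF? r idx = ≡-dec B._≟_ (r ++ drop (length r) idx) idx
             ×-dec Data.Nat._≟_ (numOnes (drop (length r) idx)) 1

f : BinStr → ℕ → ℕ
f r m = length (filter (λ π → isF? r (index π)) (S m))

-- r_ℓ^- : delete the ℓ-th letter (positions are 1-based).
del : ℕ → BinStr → BinStr
del _ [] = []
del zero xs = xs
del (suc zero) (x ∷ xs) = xs
del (suc (suc l)) (x ∷ xs) = x ∷ del (suc l) xs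

-- r_ℓ^1 : replace the ℓ-th letter by 1 (positions are 1-based).
set1 : ℕ → BinStr → BinStr
set1 _ [] = []
set1 zero xs = xs
set1 (suc zero) (x ∷ xs) = true ∷ xs
set1 (suc (suc l)) (x ∷ xs) = x ∷ set1 (suc l) xs

-- r_i (1-based); the value for out-of-range i is irrelevant.
at : BinStr → ℕ → Bool
at [] _ = false
at (x ∷ xs) zero = false
at (x ∷ xs) (suc zero) = x
at (x ∷ xs) (suc (suc i)) = at xs (suc i)

isPeak : BinStr → ℕ → Bool
isPeak r i = at r i ∧ ((i ≡ᵇ 1) ∨ not (at r (i ∸ 1)))

K : BinStr → List ℕ
K r = filter (λ i → isPeak r i B.≟ true) (map suc (upTo (length r)))

lastIs0 : BinStr → Set
lastIs0 [] = Data.Empty.⊥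
lastIs0 (x ∷ []) = x ≡ false
lastIs0 (x ∷ y ∷ xs) = lastIs0 (y ∷ xs)

sumℤ : List ℤ → ℤ
sumℤ = Data.List.foldr ℤ._+_ (ℤ.+ 0)

-- Every permutation in S_{n+1} arises exactly once by inserting n into some σ ∈ S_n, so f(r, n+1) counts
-- the pairs (σ, insertion position) whose resulting index lies in r r'. Let u be the index of σ. Inserting
-- in front prepends a descent, which contributes f(r_1^-, n) exactly when r starts with 1, i.e. when 1 is a
-- peak; every other position replaces a letter of u by 01 or appends a 0. Writing F(s) for the words s s'
-- with one 1 in s' and UD(s) for the words s 0⋯0, a case analysis on the first letters of r and u shows
-- that these positions number
--   2[u ∈ F(r)] + (|u| + 1 - k)[u ∈ UD(r)] + [u ∈ UD(r_k^1)] + Σ_{i ∈ K(r), i ≥ 2} ([u ∈ F(r_{i-1}^-)] + [u ∈ F(r_i^-)]),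
-- a peak i contributing through the insertion after the (i-1)-st letter. Summing over σ ∈ S_n gives the
-- recurrence; n - k may be read as a truncated difference because UD_n(r) = 0 whenever k > n.

module Submission where

open import Defs

module Sums where

  open import Data.Bool using (Bool; true; false)
  open import Data.List using ([]; _∷_; map; filter; length; applyUpTo; cartesianProductWith)
  open import Data.List.Properties using (map-++; map-∘)
  open import Data.List.Membership.Propositional using (_∈_)
  open import Data.List.Relation.Unary.Any using (here; there)
  open import Data.Nat using (ℕ; zero; suc; _+_; _*_)
  open import Data.Nat.ListAction using (sum)
  open import Data.Nat.ListAction.Properties using (sum-++)
  open import Data.Nat.Properties using (*-zeroʳ; *-distribˡ-+; +-identityʳ)
  open import Data.Nat.Tactic.RingSolver using (solve-∀)
  open import Function using (_∘_)
  open import Relation.Binary.PropositionalEquality using (_≡_; refl; sym; trans; cong; cong₂)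
  open import Relation.Nullary.Decidable using (does; yes; no)
  open import Relation.Unary using (Pred; Decidable)
  open import Level using (0ℓ)

  𝟙 : Bool → ℕ
  𝟙 true = 1
  𝟙 false = 0

  sumBelow : (ℕ → ℕ) → ℕ → ℕ
  sumBelow h zero = 0
  sumBelow h (suc n) = h 0 + sumBelow (h ∘ suc) n

  sumBelow-cong : ∀ {g h} n → (∀ i → g i ≡ h i) → sumBelow g n ≡ sumBelow h n
  sumBelow-cong zero g≗h = refl
  sumBelow-cong (suc n) g≗h = cong₂ _+_ (g≗h 0) (sumBelow-cong n (g≗h ∘ suc))

  sumBelow-zero : ∀ {h} n → (∀ i → h i ≡ 0) → sumBelow h n ≡ 0
  sumBelow-zero zero h≗0 = refl
  sumBelow-zero (suc n) h≗0 = cong₂ _+_ (h≗0 0) (sumBelow-zero n (h≗0 ∘ suc))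

  sum-map-applyUpTo : ∀ (h f : ℕ → ℕ) n → sum (map h (applyUpTo f n)) ≡ sumBelow (h ∘ f) n
  sum-map-applyUpTo h f zero = refl
  sum-map-applyUpTo h f (suc n) = cong (h (f 0) +_) (sum-map-applyUpTo h (f ∘ suc) n)

  module _ {A : Set} where

    sum-map-cong-∈ : ∀ {g h : A → ℕ} xs → (∀ {x} → x ∈ xs → g x ≡ h x) → sum (map g xs) ≡ sum (map h xs)
    sum-map-cong-∈ [] g≗h = refl
    sum-map-cong-∈ (x ∷ xs) g≗h = cong₂ _+_ (g≗h (here refl)) (sum-map-cong-∈ xs (g≗h ∘ there))

    sum-map-+ : ∀ (g h : A → ℕ) xs → sum (map (λ x → g x + h x) xs) ≡ sum (map g xs) + sum (map h xs)
    sum-map-+ g h [] = refl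
    sum-map-+ g h (x ∷ xs) = trans (cong (g x + h x +_) (sum-map-+ g h xs)) (swap (g x) (h x) _ _)
      where
      swap : ∀ a b c d → a + b + (c + d) ≡ a + c + (b + d)
      swap = solve-∀

    sum-map-*ˡ : ∀ c (g : A → ℕ) xs → sum (map (λ x → c * g x) xs) ≡ c * sum (map g xs)
    sum-map-*ˡ c g [] = sym (*-zeroʳ c)
    sum-map-*ˡ c g (x ∷ xs) = trans (cong (c * g x +_) (sum-map-*ˡ c g xs)) (sym (*-distribˡ-+ c (g x) _))

    sum-map-zero : ∀ {h : A → ℕ} xs → (∀ {x} → x ∈ xs → h x ≡ 0) → sum (map h xs) ≡ 0
    sum-map-zero xs h≗0 = trans (sum-map-cong-∈ {h = λ _ → 0} xs h≗0) (sum-zeros xs)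
      where
      sum-zeros : ∀ xs → sum (map (λ _ → 0) xs) ≡ 0
      sum-zeros [] = refl
      sum-zeros (_ ∷ xs) = sum-zeros xs

    sum-map-sumBelow : ∀ (H : ℕ → A → ℕ) k xs →
      sum (map (λ x → sumBelow (λ i → H i x) k) xs) ≡ sumBelow (λ i → sum (map (H i) xs)) k
    sum-map-sumBelow H zero xs = sum-map-zero xs (λ _ → refl)
    sum-map-sumBelow H (suc k) xs =
      trans (sum-map-+ (H 0) (λ x → sumBelow (λ i → H (suc i) x) k) xs)
            (cong (sum (map (H 0) xs) +_) (sum-map-sumBelow (H ∘ suc) k xs))

    module _ {P : Pred A 0ℓ} (P? : Decidable P) where

      length-filter≡sum : ∀ xs → length (filter P? xs) ≡ sum (map (λ x → 𝟙 (does (P? x))) xs)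
      length-filter≡sum [] = refl
      length-filter≡sum (x ∷ xs) with P? x
      ... | yes _ = cong suc (length-filter≡sum xs)
      ... | no _ = length-filter≡sum xs

      sum-map-filter : ∀ (h : A → ℕ) xs → sum (map h (filter P? xs)) ≡ sum (map (λ x → 𝟙 (does (P? x)) * h x) xs)
      sum-map-filter h [] = refl
      sum-map-filter h (x ∷ xs) with P? x
      ... | yes _ = cong₂ _+_ (sym (+-identityʳ (h x))) (sum-map-filter h xs)
      ... | no _ = sum-map-filter h xs

  sum-map-cartesianProductWith : ∀ {A B C : Set} (f : A → B → C) (h : C → ℕ) xs ys →
    sum (map h (cartesianProductWith f xs ys)) ≡ sum (map (λ x → sum (map (h ∘ f x) ys)) xs)
  sum-map-cartesianProductWith f h [] ys = refl
  sum-map-cartesianProductWith f h (x ∷ xs) ys =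
    trans (cong sum (map-++ h (map (f x) ys) (cartesianProductWith f xs ys)))
    (trans (sum-++ (map h (map (f x) ys)) _)
           (cong₂ _+_ (cong sum (sym (map-∘ ys))) (sum-map-cartesianProductWith f h xs ys)))

module DescentWords where

  open Sums
  open import Data.Bool using (true; false; _∧_; not)
  import Data.Bool as Bool
  open import Data.List using ([]; _∷_; _++_; length; replicate)
  open import Data.List.Properties using (∷-injective; drop-[]; length-++)
  open import Data.Nat using (ℕ; zero; suc; _+_; _*_; _∸_; _≤_; _<_)
  open import Data.Nat.Properties
    using (suc-injective; 0≢1+n; <⇒≱; m≤m+n; ≤-trans; ≤-reflexive; +-assoc; +-identityʳ; *-identityˡ; *-zeroʳ)
  open import Data.Nat.Tactic.RingSolver using (solve-∀)
  open import Data.Empty using (⊥-elim)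
  open import Data.Product using (_,_; proj₁; proj₂)
  open import Function using (_∘_; _⇔_; mk⇔)
  open import Relation.Binary.PropositionalEquality using (_≡_; _≢_; refl; sym; trans; cong; cong₂; module ≡-Reasoning)
  open import Relation.Nullary using (¬_)
  open import Relation.Nullary.Decidable using (Dec; does; does-⇔; dec-false)
  open import Algebra.Properties.CommutativeSemigroup Data.Nat.Properties.+-commutativeSemigroup using (x∙yz≈y∙xz)

  χF χUD : BinStr → BinStr → ℕ
  χF r w = 𝟙 (does (isF? r w))
  χUD r w = 𝟙 (does (isUD? r w))

  private
    cong₃ : ∀ {A B C D : Set} (f : A → B → C → D) {x x' y y' z z'} →
            x ≡ x' → y ≡ y' → z ≡ z' → f x y z ≡ f x' y' z'
    cong₃ f refl refl refl = refl

    𝟙-does-⇔ : ∀ {A B : Set} → A ⇔ B → (a? : Dec A) (b? : Dec B) → 𝟙 (does a?) ≡ 𝟙 (does b?)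
    𝟙-does-⇔ A⇔B a? b? = cong 𝟙 (does-⇔ A⇔B a? b?)

    𝟙-does-¬ : ∀ {A : Set} → ¬ A → (a? : Dec A) → 𝟙 (does a?) ≡ 0
    𝟙-does-¬ ¬a a? = cong 𝟙 (dec-false a? ¬a)

  numOnes-replicate : ∀ n → numOnes (replicate n false) ≡ 0
  numOnes-replicate zero = refl
  numOnes-replicate (suc n) = numOnes-replicate n

  numOnes≡0⇒replicate : ∀ w → numOnes w ≡ 0 → w ≡ replicate (length w) false
  numOnes≡0⇒replicate [] _ = refl
  numOnes≡0⇒replicate (false ∷ w) e = cong (false ∷_) (numOnes≡0⇒replicate w e)

  χF-∷ : ∀ x s w → χF (x ∷ s) (x ∷ w) ≡ χF s w
  χF-∷ x s w = 𝟙-does-⇔ (mk⇔ (λ (e , o) → proj₂ (∷-injective e) , o) (λ (e , o) → cong (x ∷_) e , o))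
    (isF? (x ∷ s) (x ∷ w)) (isF? s w)

  χF-≢ : ∀ {x y} s w → x ≢ y → χF (x ∷ s) (y ∷ w) ≡ 0
  χF-≢ s w x≢y = 𝟙-does-¬ (λ (e , _) → x≢y (proj₁ (∷-injective e))) (isF? (_ ∷ s) (_ ∷ w))

  χF-[] : ∀ s → χF s [] ≡ 0
  χF-[] s = 𝟙-does-¬ (λ (_ , o) → 0≢1+n (trans (cong numOnes (sym (drop-[] (length s)))) o)) (isF? s [])

  χUD-∷ : ∀ x s w → χUD (x ∷ s) (x ∷ w) ≡ χUD s w
  χUD-∷ x s w = 𝟙-does-⇔ (mk⇔ (proj₂ ∘ ∷-injective) (cong (x ∷_))) (isUD? (x ∷ s) (x ∷ w)) (isUD? s w)

  χUD-≢ : ∀ {x y} s w → x ≢ y → χUD (x ∷ s) (y ∷ w) ≡ 0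
  χUD-≢ s w x≢y = 𝟙-does-¬ (λ e → x≢y (sym (proj₁ (∷-injective e)))) (isUD? (_ ∷ s) (_ ∷ w))

  χUD-[] : ∀ x s → χUD (x ∷ s) [] ≡ 0
  χUD-[] x s = 𝟙-does-¬ (λ ()) (isUD? (x ∷ s) [])

  χUD-short : ∀ r u → length u < length r → χUD r u ≡ 0
  χUD-short r u u<r = 𝟙-does-¬ (λ e → <⇒≱ u<r (prefix≤ e)) (isUD? r u)
    where
    prefix≤ : ∀ {v} → u ≡ r ++ v → length r ≤ length u
    prefix≤ e = ≤-trans (m≤m+n (length r) _) (≤-reflexive (sym (trans (cong length e) (length-++ r))))

  χF[]-false∷ : ∀ w → χF [] (false ∷ w) ≡ χF [] w
  χF[]-false∷ w = 𝟙-does-⇔ (mk⇔ (λ (_ , o) → refl , o) (λ (_ , o) → refl , o)) (isF? [] (false ∷ w)) (isF? [] w)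

  χF[]-true∷ : ∀ w → χF [] (true ∷ w) ≡ χUD [] w
  χF[]-true∷ w = 𝟙-does-⇔ (mk⇔ (λ (_ , o) → numOnes≡0⇒replicate w (suc-injective o))
                               (λ e → refl , cong suc (trans (cong numOnes e) (numOnes-replicate (length w)))))
    (isF? [] (true ∷ w)) (isUD? [] w)

  χUD[]-false∷ : ∀ w → χUD [] (false ∷ w) ≡ χUD [] w
  χUD[]-false∷ w = 𝟙-does-⇔ (mk⇔ (proj₂ ∘ ∷-injective) (cong (false ∷_))) (isUD? [] (false ∷ w)) (isUD? [] w)

  χUD[]-true∷ : ∀ w → χUD [] (true ∷ w) ≡ 0
  χUD[]-true∷ w = 𝟙-does-¬ (λ ()) (isUD? [] (true ∷ w))

  χF-true∷ : ∀ a s w → χF (a ∷ s) (true ∷ w) ≡ 𝟙 a * χF s w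
  χF-true∷ true s w = trans (χF-∷ true s w) (sym (*-identityˡ _))
  χF-true∷ false s w = χF-≢ {false} {true} s w (λ ())

  χF-false∷true∷ : ∀ a b s w →
    χF (a ∷ b ∷ s) (false ∷ true ∷ w) ≡ 𝟙 (b ∧ not a) * (χF (b ∷ s) (a ∷ w) + χF s w)
  χF-false∷true∷ false false s w = trans (χF-∷ false (false ∷ s) (true ∷ w)) (χF-≢ {false} {true} s w (λ ()))
  χF-false∷true∷ false true s w = begin
    χF (false ∷ true ∷ s) (false ∷ true ∷ w) ≡⟨ χF-∷ false (true ∷ s) (true ∷ w) ⟩
    χF (true ∷ s) (true ∷ w)                 ≡⟨ χF-∷ true s w ⟩
    χF s w                                   ≡⟨ cong (_+ χF s w) (χF-≢ {true} {false} s w (λ ())) ⟨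
    χF (true ∷ s) (false ∷ w) + χF s w       ≡⟨ *-identityˡ _ ⟨
    1 * (χF (true ∷ s) (false ∷ w) + χF s w) ∎
    where open ≡-Reasoning
  χF-false∷true∷ true false s w = χF-≢ {true} {false} (false ∷ s) (true ∷ w) (λ ())
  χF-false∷true∷ true true s w = χF-≢ {true} {false} (true ∷ s) (true ∷ w) (λ ())

  χF-false∷true∷-≢ : ∀ {a x} b s w → a ≢ x →
    χF (a ∷ b ∷ s) (false ∷ true ∷ w) ≡ 𝟙 (b ∧ not a) * χF (b ∷ s) (x ∷ w)
  χF-false∷true∷-≢ {false} {false} b s w a≢x = ⊥-elim (a≢x refl)
  χF-false∷true∷-≢ {false} {true} false s w _ = trans (χF-∷ false (false ∷ s) (true ∷ w)) (χF-≢ {false} {true} s w (λ ()))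
  χF-false∷true∷-≢ {false} {true} true s w _ = trans (χF-∷ false (true ∷ s) (true ∷ w)) (sym (*-identityˡ _))
  χF-false∷true∷-≢ {true} {false} false s w _ = χF-≢ {true} {false} (false ∷ s) (true ∷ w) (λ ())
  χF-false∷true∷-≢ {true} {false} true s w _ = χF-≢ {true} {false} (true ∷ s) (true ∷ w) (λ ())
  χF-false∷true∷-≢ {true} {true} b s w a≢x = ⊥-elim (a≢x refl)

  -- If u is the index of σ ∈ S_m, then insertMaxIndex j u is the index of σ with m inserted after its
  -- first j letters: a leading descent for j = 0, the letter u_j replaced by the ascent-descent pair 01
  -- for 0 < j ≤ |u|, and a trailing ascent for j = m.
  insertMaxIndex : ℕ → BinStr → BinStr
  insertMaxIndex zero u = true ∷ u
  insertMaxIndex (suc zero) [] = false ∷ []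
  insertMaxIndex (suc zero) (b ∷ u) = false ∷ true ∷ u
  insertMaxIndex (suc (suc j)) [] = false ∷ []
  insertMaxIndex (suc (suc j)) (b ∷ u) = b ∷ insertMaxIndex (suc j) u

  insertionSum : (BinStr → ℕ) → BinStr → ℕ
  insertionSum g u = sumBelow (λ j → g (insertMaxIndex (suc j) u)) (suc (length u))

  insertionSum-cong : ∀ {g h} u → (∀ w → g w ≡ h w) → insertionSum g u ≡ insertionSum h u
  insertionSum-cong u g≗h = sumBelow-cong (suc (length u)) (λ j → g≗h (insertMaxIndex (suc j) u))

  insertionSum-zero : ∀ {g} u → (∀ w → g w ≡ 0) → insertionSum g u ≡ 0
  insertionSum-zero u g≗0 = sumBelow-zero (suc (length u)) (λ j → g≗0 (insertMaxIndex (suc j) u))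

  peakSum≥2 : BinStr → (ℕ → ℕ) → ℕ
  peakSum≥2 r H = sumBelow (λ i → 𝟙 (isPeak r (2 + i)) * H (2 + i)) (length r ∸ 1)

  peakSum≥2-cong : ∀ r H H' → (∀ i → H (2 + i) ≡ H' (2 + i)) → peakSum≥2 r H ≡ peakSum≥2 r H'
  peakSum≥2-cong r H H' H≗H' = sumBelow-cong (length r ∸ 1) (λ i → cong (𝟙 (isPeak r (2 + i)) *_) (H≗H' i))

  peakSum≥2-zero : ∀ r H → (∀ i → H (2 + i) ≡ 0) → peakSum≥2 r H ≡ 0
  peakSum≥2-zero r H H≗0 =
    sumBelow-zero (length r ∸ 1) (λ i → trans (cong (𝟙 (isPeak r (2 + i)) *_) (H≗0 i)) (*-zeroʳ (𝟙 (isPeak r (2 + i)))))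

  peakSum≥2-∷∷ : ∀ a b s H → peakSum≥2 (a ∷ b ∷ s) H ≡ 𝟙 (b ∧ not a) * H 2 + peakSum≥2 (b ∷ s) (H ∘ suc)
  peakSum≥2-∷∷ a b s H = refl

  peakTerm : (BinStr → ℕ) → BinStr → ℕ → ℕ
  peakTerm F r p = F (del (p ∸ 1) r) + F (del p r)

  -- The right-hand side of the recurrence with f(·, n), UD_n and n - |r| abstracted as F, U and c,
  -- so that it can also be instantiated pointwise with χF and χUD.
  recurrenceBody : (BinStr → ℕ) → (BinStr → ℕ) → ℕ → BinStr → ℕ
  recurrenceBody F U c r = 2 * F r + c * U r + U (set1 (length r) r) + peakSum≥2 r (peakTerm F r)

  recurrenceBody-cong : ∀ {F F' U U'} c r → (∀ s → F s ≡ F' s) → (∀ s → U s ≡ U' s) →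
    recurrenceBody F U c r ≡ recurrenceBody F' U' c r
  recurrenceBody-cong {F} {F'} c r F≗F' U≗U' =
    cong₂ _+_ (cong₂ _+_ (cong₂ _+_ (cong (2 *_) (F≗F' r)) (cong (c *_) (U≗U' r))) (U≗U' (set1 (length r) r)))
              (peakSum≥2-cong r (peakTerm F r) (peakTerm F' r)
                 (λ i → cong₂ _+_ (F≗F' (del (1 + i) r)) (F≗F' (del (2 + i) r))))

  insertionSum-χUD[] : ∀ u → insertionSum (χUD []) u ≡ χUD [] u
  insertionSum-χUD[] [] = refl
  insertionSum-χUD[] (false ∷ u) = begin
    χUD [] (false ∷ true ∷ u) + insertionSum (χUD [] ∘ (false ∷_)) u
      ≡⟨ cong₂ _+_ (trans (χUD[]-false∷ (true ∷ u)) (χUD[]-true∷ u)) (insertionSum-cong u χUD[]-false∷) ⟩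
    insertionSum (χUD []) u
      ≡⟨ insertionSum-χUD[] u ⟩
    χUD [] u
      ≡⟨ χUD[]-false∷ u ⟨
    χUD [] (false ∷ u) ∎
    where open ≡-Reasoning
  insertionSum-χUD[] (true ∷ u) =
    trans (cong₂ _+_ (trans (χUD[]-false∷ (true ∷ u)) (χUD[]-true∷ u)) (insertionSum-zero u χUD[]-true∷))
          (sym (χUD[]-true∷ u))

  insertionSum-χF[] : ∀ u → insertionSum (χF []) u ≡ length u * χUD [] u + 2 * χF [] u
  insertionSum-χF[] [] = refl
  insertionSum-χF[] (false ∷ u) = begin
    χF [] (false ∷ true ∷ u) + insertionSum (χF [] ∘ (false ∷_)) u
      ≡⟨ cong₂ _+_ (trans (χF[]-false∷ (true ∷ u)) (χF[]-true∷ u))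
                   (trans (insertionSum-cong u χF[]-false∷) (insertionSum-χF[] u)) ⟩
    χUD [] u + (length u * χUD [] u + 2 * χF [] u)
      ≡⟨ +-assoc (χUD [] u) _ _ ⟨
    suc (length u) * χUD [] u + 2 * χF [] u
      ≡⟨ cong₂ (λ x y → suc (length u) * x + 2 * y) (χUD[]-false∷ u) (χF[]-false∷ u) ⟨
    suc (length u) * χUD [] (false ∷ u) + 2 * χF [] (false ∷ u) ∎
    where open ≡-Reasoning
  insertionSum-χF[] (true ∷ u) = begin
    χF [] (false ∷ true ∷ u) + insertionSum (χF [] ∘ (true ∷_)) u
      ≡⟨ cong₂ _+_ (trans (χF[]-false∷ (true ∷ u)) (χF[]-true∷ u))
                   (trans (insertionSum-cong u χF[]-true∷) (insertionSum-χUD[] u)) ⟩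
    χUD [] u + χUD [] u
      ≡⟨ cong (χUD [] u +_) (+-identityʳ (χUD [] u)) ⟨
    2 * χUD [] u
      ≡⟨ cong (_+ 2 * χUD [] u) (*-zeroʳ (suc (length u))) ⟨
    suc (length u) * 0 + 2 * χUD [] u
      ≡⟨ cong₂ (λ x y → suc (length u) * x + 2 * y) (χUD[]-true∷ u) (χF[]-true∷ u) ⟨
    suc (length u) * χUD [] (true ∷ u) + 2 * χF [] (true ∷ u) ∎
    where open ≡-Reasoning

  insertionSum-χF[false] : ∀ u →
    insertionSum (χF (false ∷ [])) u ≡ recurrenceBody (λ r → χF r u) (λ r → χUD r u) (length u) (false ∷ [])
  insertionSum-χF[false] [] = refl
  insertionSum-χF[false] (false ∷ u) = begin
    χF (false ∷ []) (false ∷ true ∷ u) + insertionSum (χF (false ∷ []) ∘ (false ∷_)) u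
      ≡⟨ cong₂ _+_ (trans (χF-∷ false [] (true ∷ u)) (χF[]-true∷ u))
                   (trans (insertionSum-cong u (χF-∷ false [])) (insertionSum-χF[] u)) ⟩
    χUD [] u + (length u * χUD [] u + 2 * χF [] u)
      ≡⟨ rearrange (length u) (χUD [] u) (χF [] u) ⟩
    2 * χF [] u + suc (length u) * χUD [] u + 0 + 0
      ≡⟨ cong₂ (λ x y → 2 * x + suc (length u) * y + 0 + 0) (χF-∷ false [] u) (χUD-∷ false [] u) ⟨
    2 * χF (false ∷ []) (false ∷ u) + suc (length u) * χUD (false ∷ []) (false ∷ u) + 0 + 0
      ≡⟨ cong (λ x → 2 * χF (false ∷ []) (false ∷ u) + suc (length u) * χUD (false ∷ []) (false ∷ u) + x + 0)
              (χUD-≢ {true} {false} [] u (λ ())) ⟨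
    recurrenceBody (λ r → χF r (false ∷ u)) (λ r → χUD r (false ∷ u)) (suc (length u)) (false ∷ []) ∎
    where
    open ≡-Reasoning
    rearrange : ∀ l z e → z + (l * z + 2 * e) ≡ 2 * e + suc l * z + 0 + 0
    rearrange = solve-∀
  insertionSum-χF[false] (true ∷ u) = begin
    χF (false ∷ []) (false ∷ true ∷ u) + insertionSum (χF (false ∷ []) ∘ (true ∷_)) u
      ≡⟨ cong₂ _+_ (trans (χF-∷ false [] (true ∷ u)) (χF[]-true∷ u))
                   (insertionSum-zero u (λ w → χF-≢ {false} {true} [] w (λ ()))) ⟩
    χUD [] u + 0
      ≡⟨ rearrange (length u) (χUD [] u) ⟩
    2 * 0 + suc (length u) * 0 + χUD [] u + 0
      ≡⟨ cong₃ (λ x y z → 2 * x + suc (length u) * y + z + 0)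
               (χF-≢ {false} {true} [] u (λ ())) (χUD-≢ {false} {true} [] u (λ ())) (χUD-∷ true [] u) ⟨
    recurrenceBody (λ r → χF r (true ∷ u)) (λ r → χUD r (true ∷ u)) (suc (length u)) (false ∷ []) ∎
    where
    open ≡-Reasoning
    rearrange : ∀ l z → z + 0 ≡ 2 * 0 + suc l * 0 + z + 0
    rearrange = solve-∀

  recurrenceBody-∷-same : ∀ a b s u c →
    recurrenceBody (λ r → χF r (a ∷ u)) (λ r → χUD r (a ∷ u)) c (a ∷ b ∷ s)
      ≡ 𝟙 (b ∧ not a) * (χF (b ∷ s) (a ∷ u) + χF s u) + recurrenceBody (λ r → χF r u) (λ r → χUD r u) c (b ∷ s)
  recurrenceBody-∷-same a b s u c = begin
    2 * χF r (a ∷ u) + c * χUD r (a ∷ u) + χUD (set1 (length r) r) (a ∷ u) + peakSum≥2 r (peakTerm Fₐ r)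
      ≡⟨ cong (2 * χF r (a ∷ u) + c * χUD r (a ∷ u) + χUD (set1 (length r) r) (a ∷ u) +_)
              (peakSum≥2-∷∷ a b s (peakTerm Fₐ r)) ⟩
    2 * χF r (a ∷ u) + c * χUD r (a ∷ u) + χUD (a ∷ set1 (length t) t) (a ∷ u)
      + (𝟙 (b ∧ not a) * (χF t (a ∷ u) + χF (a ∷ s) (a ∷ u)) + peakSum≥2 t (peakTerm Fₐ r ∘ suc))
      ≡⟨ cong₂ _+_ (cong₃ (λ x y z → 2 * x + c * y + z) (χF-∷ a t u) (χUD-∷ a t u) (χUD-∷ a (set1 (length t) t) u))
                   (cong₂ _+_ (cong (λ x → 𝟙 (b ∧ not a) * (χF t (a ∷ u) + x)) (χF-∷ a s u))
                              (peakSum≥2-cong t (peakTerm Fₐ r ∘ suc) (peakTerm F t)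
                                 (λ i → cong₂ _+_ (χF-∷ a (del (1 + i) t) u) (χF-∷ a (del (2 + i) t) u)))) ⟩
    2 * χF t u + c * χUD t u + χUD (set1 (length t) t) u
      + (𝟙 (b ∧ not a) * (χF t (a ∷ u) + χF s u) + peakSum≥2 t (peakTerm F t))
      ≡⟨ x∙yz≈y∙xz (2 * χF t u + c * χUD t u + χUD (set1 (length t) t) u) (𝟙 (b ∧ not a) * (χF t (a ∷ u) + χF s u))
                   (peakSum≥2 t (peakTerm F t)) ⟩
    𝟙 (b ∧ not a) * (χF t (a ∷ u) + χF s u) + recurrenceBody F (λ r → χUD r u) c t ∎
    where
    open ≡-Reasoning
    t r : BinStr
    t = b ∷ s
    r = a ∷ t
    F Fₐ : BinStr → ℕ
    F r = χF r u
    Fₐ r = χF r (a ∷ u)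

  recurrenceBody-∷-≢ : ∀ {a x} b s u c → a ≢ x →
    recurrenceBody (λ r → χF r (x ∷ u)) (λ r → χUD r (x ∷ u)) c (a ∷ b ∷ s) ≡ 𝟙 (b ∧ not a) * χF (b ∷ s) (x ∷ u)
  recurrenceBody-∷-≢ {a} {x} b s u c a≢x = begin
    2 * χF r (x ∷ u) + c * χUD r (x ∷ u) + χUD (set1 (length r) r) (x ∷ u) + peakSum≥2 r (peakTerm Fₓ r)
      ≡⟨ cong (2 * χF r (x ∷ u) + c * χUD r (x ∷ u) + χUD (set1 (length r) r) (x ∷ u) +_)
              (peakSum≥2-∷∷ a b s (peakTerm Fₓ r)) ⟩
    2 * χF r (x ∷ u) + c * χUD r (x ∷ u) + χUD (a ∷ set1 (length t) t) (x ∷ u)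
      + (𝟙 (b ∧ not a) * (χF t (x ∷ u) + χF (a ∷ s) (x ∷ u)) + peakSum≥2 t (peakTerm Fₓ r ∘ suc))
      ≡⟨ cong₂ _+_ (cong₃ (λ x y z → 2 * x + c * y + z)
                          (χF-≢ t u a≢x) (χUD-≢ t u a≢x) (χUD-≢ (set1 (length t) t) u a≢x))
                   (cong₂ _+_ (cong (λ y → 𝟙 (b ∧ not a) * (χF t (x ∷ u) + y)) (χF-≢ s u a≢x))
                              (peakSum≥2-zero t (peakTerm Fₓ r ∘ suc)
                                 (λ i → cong₂ _+_ (χF-≢ (del (1 + i) t) u a≢x) (χF-≢ (del (2 + i) t) u a≢x)))) ⟩
    2 * 0 + c * 0 + 0 + (𝟙 (b ∧ not a) * (χF t (x ∷ u) + 0) + 0)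
      ≡⟨ simplify c (𝟙 (b ∧ not a)) (χF t (x ∷ u)) ⟩
    𝟙 (b ∧ not a) * χF t (x ∷ u) ∎
    where
    open ≡-Reasoning
    t r : BinStr
    t = b ∷ s
    r = a ∷ t
    Fₓ : BinStr → ℕ
    Fₓ r = χF r (x ∷ u)
    simplify : ∀ c p y → 2 * 0 + c * 0 + 0 + (p * (y + 0) + 0) ≡ p * y
    simplify = solve-∀

  insertionSum-χF-∷∷-same : ∀ a b s u →
    insertionSum (χF (b ∷ s)) u
      ≡ recurrenceBody (λ r → χF r u) (λ r → χUD r u) (suc (length u) ∸ length (b ∷ s)) (b ∷ s) →
    insertionSum (χF (a ∷ b ∷ s)) (a ∷ u)
      ≡ recurrenceBody (λ r → χF r (a ∷ u)) (λ r → χUD r (a ∷ u)) (suc (length u) ∸ length (b ∷ s)) (a ∷ b ∷ s)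
  insertionSum-χF-∷∷-same a b s u ih = begin
    χF (a ∷ b ∷ s) (false ∷ true ∷ u) + insertionSum (χF (a ∷ b ∷ s) ∘ (a ∷_)) u
      ≡⟨ cong₂ _+_ (χF-false∷true∷ a b s u) (trans (insertionSum-cong u (χF-∷ a (b ∷ s))) ih) ⟩
    𝟙 (b ∧ not a) * (χF (b ∷ s) (a ∷ u) + χF s u)
      + recurrenceBody (λ r → χF r u) (λ r → χUD r u) (suc (length u) ∸ length (b ∷ s)) (b ∷ s)
      ≡⟨ recurrenceBody-∷-same a b s u (suc (length u) ∸ length (b ∷ s)) ⟨
    recurrenceBody (λ r → χF r (a ∷ u)) (λ r → χUD r (a ∷ u)) (suc (length u) ∸ length (b ∷ s)) (a ∷ b ∷ s) ∎
    where open ≡-Reasoning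

  insertionSum-χF-∷∷-≢ : ∀ {a x} b s u → a ≢ x →
    insertionSum (χF (a ∷ b ∷ s)) (x ∷ u)
      ≡ recurrenceBody (λ r → χF r (x ∷ u)) (λ r → χUD r (x ∷ u)) (suc (length u) ∸ length (b ∷ s)) (a ∷ b ∷ s)
  insertionSum-χF-∷∷-≢ {a} {x} b s u a≢x = begin
    χF (a ∷ b ∷ s) (false ∷ true ∷ u) + insertionSum (χF (a ∷ b ∷ s) ∘ (x ∷_)) u
      ≡⟨ cong₂ _+_ (χF-false∷true∷-≢ b s u a≢x) (insertionSum-zero u (λ w → χF-≢ (b ∷ s) w a≢x)) ⟩
    𝟙 (b ∧ not a) * χF (b ∷ s) (x ∷ u) + 0
      ≡⟨ +-identityʳ _ ⟩
    𝟙 (b ∧ not a) * χF (b ∷ s) (x ∷ u)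
      ≡⟨ recurrenceBody-∷-≢ b s u (suc (length u) ∸ length (b ∷ s)) a≢x ⟨
    recurrenceBody (λ r → χF r (x ∷ u)) (λ r → χUD r (x ∷ u)) (suc (length u) ∸ length (b ∷ s)) (a ∷ b ∷ s) ∎
    where open ≡-Reasoning

  insertionSum-χF : ∀ r u → lastIs0 r →
    insertionSum (χF r) u ≡ recurrenceBody (λ s → χF s u) (λ s → χUD s u) (suc (length u) ∸ length r) r
  insertionSum-χF (false ∷ []) u refl = insertionSum-χF[false] u
  insertionSum-χF (a ∷ b ∷ s) [] _ = trans (χF-[a]-[false] a) (sym (
    cong₂ _+_ (cong₃ (λ x y z → 2 * x + 0 * y + z) (χF-[] r) (χUD-[] a (b ∷ s)) (χUD-[] a (set1 (length (b ∷ s)) (b ∷ s))))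
              (peakSum≥2-zero r (peakTerm (λ r → χF r []) r) (λ i → cong₂ _+_ (χF-[] (del (1 + i) r)) (χF-[] (del (2 + i) r))))))
    where
    r : BinStr
    r = a ∷ b ∷ s
    χF-[a]-[false] : ∀ a → χF (a ∷ b ∷ s) (false ∷ []) + 0 ≡ 0
    χF-[a]-[false] false = trans (+-identityʳ _) (trans (χF-∷ false (b ∷ s) []) (χF-[] (b ∷ s)))
    χF-[a]-[false] true = trans (+-identityʳ _) (χF-≢ {true} {false} (b ∷ s) [] (λ ()))
  insertionSum-χF (false ∷ b ∷ s) (false ∷ u) last = insertionSum-χF-∷∷-same false b s u (insertionSum-χF (b ∷ s) u last)
  insertionSum-χF (true ∷ b ∷ s) (true ∷ u) last = insertionSum-χF-∷∷-same true b s u (insertionSum-χF (b ∷ s) u last)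
  insertionSum-χF (false ∷ b ∷ s) (true ∷ u) _ = insertionSum-χF-∷∷-≢ {false} {true} b s u (λ ())
  insertionSum-χF (true ∷ b ∷ s) (false ∷ u) _ = insertionSum-χF-∷∷-≢ {true} {false} b s u (λ ())

module Permutations where

  open Sums
  open DescentWords using (insertMaxIndex; insertionSum)
  open import Data.Bool using (true; false)
  open import Data.Fin using (Fin; toℕ; fromℕ; inject₁; lower₁)
  import Data.Fin as Fin
  open import Data.Fin.Properties
    using (toℕ-inject₁; toℕ-fromℕ; toℕ<n; toℕ-injective; inject₁-injective; inject₁-lower₁; fromℕ≢inject₁; injective⇒≤)
  open import Data.List using (List; []; _∷_; _++_; length; map; replicate; allFin; upTo; concatMap; cartesianProductWith; lookup)
  open import Data.List.Properties using (∷-injective; map-injective; map-++; length-map; length-++; length-replicate)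
  open import Data.List.Membership.Propositional using (_∈_; _∉_)
  open import Data.List.Membership.Propositional.Properties
    using (∈-map⁻; ∈-allFin; ∈-filter⁺; ∈-filter⁻; ∈-∃++; ∈-lookup; ∈-upTo⁺; ∈-upTo⁻;
           ∈-cartesianProductWith⁺; ∈-cartesianProductWith⁻)
  open import Data.List.Membership.Propositional.Properties.WithK using (unique∧set⇒bag)
  import Data.List.Membership.DecPropositional as DecMembership
  open import Data.List.Relation.Binary.BagAndSetEquality using (∼bag⇒↭)
  open import Data.List.Relation.Binary.Permutation.Propositional using (_↭_; ↭⇒↭ₛ)
  open import Data.List.Relation.Binary.Permutation.Propositional.Properties using (shift)
  import Data.List.Relation.Binary.Permutation.Propositional.Properties as Perm
  open import Data.List.Relation.Binary.Permutation.Setoid.Properties using (Unique-resp-↭)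
  open import Data.List.Relation.Unary.All as All using (All; []; _∷_)
  import Data.List.Relation.Unary.All.Properties as All
  open import Data.List.Relation.Unary.Any using (here; there)
  open import Data.List.Relation.Unary.AllPairs using ([]; _∷_)
  open import Data.List.Relation.Unary.Unique.Propositional using (Unique)
  import Data.List.Relation.Unary.Unique.Propositional.Properties as Unique
  open import Data.Nat using (ℕ; zero; suc; _+_; _∸_; _≤_; _<_; _<ᵇ_; s≤s; s≤s⁻¹)
  open import Data.Nat.ListAction using (sum)
  open import Data.Nat.ListAction.Properties using (sum-↭)
  open import Data.Nat.Properties using (suc-injective; m≤m+n; <⇒≤; n<1+n; <⇒≱; +-suc)
  open import Data.Product using (_×_; _,_; proj₁; proj₂; ∃)
  open import Data.Sum using (_⊎_; inj₁; inj₂)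
  open import Data.Empty using (⊥-elim)
  open import Function using (_∘_; id; flip; mk⇔)
  open import Relation.Binary.PropositionalEquality
    using (_≡_; _≢_; refl; sym; trans; cong; cong₂; subst; subst₂; setoid; module ≡-Reasoning)
  open import Relation.Nullary using (Dec; yes; no)
  import Data.List.Relation.Unary.Unique.DecPropositional as UDec

  words-suc : ∀ m n → words m (suc n) ≡ cartesianProductWith (flip _∷_) (words m n) (allFin m)
  words-suc m n = concatMap≡ (words m n)
    where
    concatMap≡ : ∀ ws → concatMap (λ w → map (_∷ w) (allFin m)) ws ≡ cartesianProductWith (flip _∷_) ws (allFin m)
    concatMap≡ [] = refl
    concatMap≡ (w ∷ ws) = cong (map (_∷ w) (allFin m) ++_) (concatMap≡ ws)

  words-unique : ∀ m n → Unique (words m n)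
  words-unique m zero = [] ∷ []
  words-unique m (suc n) = subst Unique (sym (words-suc m n))
    (Unique.cartesianProductWith⁺ (flip _∷_) (λ e → proj₂ (∷-injective e) , proj₁ (∷-injective e))
                                  (words-unique m n) (Unique.allFin⁺ m))

  ∈-words⁺ : ∀ {m} (w : List (Fin m)) → w ∈ words m (length w)
  ∈-words⁺ [] = here refl
  ∈-words⁺ {m} (x ∷ w) = subst (x ∷ w ∈_) (sym (words-suc m (length w)))
    (∈-cartesianProductWith⁺ (flip _∷_) (∈-words⁺ w) (∈-allFin x))

  ∈-words⁻ : ∀ {m} n {w : List (Fin m)} → w ∈ words m n → length w ≡ n
  ∈-words⁻ zero (here refl) = refl
  ∈-words⁻ {m} (suc n) w∈
    with v , x , v∈ , _ , refl ← ∈-cartesianProductWith⁻ (flip _∷_) (words m n) (allFin m) (subst (_ ∈_) (words-suc m n) w∈)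
    = cong suc (∈-words⁻ n v∈)

  private
    unique? : ∀ m (w : List (Fin m)) → Dec (Unique w)
    unique? m = UDec.unique? (Fin._≟_ {m})

  S-unique : ∀ m → Unique (S m)
  S-unique m = Unique.filter⁺ (unique? m) (words-unique m m)

  ∈S⁺ : ∀ {m π} → length π ≡ m → Unique π → π ∈ S m
  ∈S⁺ {m} {π} len u = ∈-filter⁺ (unique? m) (subst (λ n → π ∈ words m n) len (∈-words⁺ π)) u

  ∈S⁻ : ∀ {m π} → π ∈ S m → length π ≡ m × Unique π
  ∈S⁻ {m} π∈ with π∈words , u ← ∈-filter⁻ (unique? m) {xs = words m m} π∈ = ∈-words⁻ m π∈words , u

  -- Past the end of σ the new maximum is repeated; this junk keeps insertMax injective in both arguments.
  insertMax : ∀ {m} → List (Fin m) → ℕ → List (Fin (suc m))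
  insertMax {m} σ zero = fromℕ m ∷ map inject₁ σ
  insertMax {m} [] (suc j) = fromℕ m ∷ fromℕ m ∷ replicate j (fromℕ m)
  insertMax (x ∷ σ) (suc j) = inject₁ x ∷ insertMax σ j

  insertMax-injective : ∀ {m} (σ σ' : List (Fin m)) j j' → insertMax σ j ≡ insertMax σ' j' → σ ≡ σ' × j ≡ j'
  insertMax-injective σ σ' zero zero e = map-injective inject₁-injective (proj₂ (∷-injective e)) , refl
  insertMax-injective [] [] zero (suc j') ()
  insertMax-injective (y ∷ σ) [] zero (suc j') e =
    ⊥-elim (fromℕ≢inject₁ {i = y} (sym (proj₁ (∷-injective (proj₂ (∷-injective e))))))
  insertMax-injective σ (x ∷ σ') zero (suc j') e = ⊥-elim (fromℕ≢inject₁ {i = x} (proj₁ (∷-injective e)))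
  insertMax-injective [] [] (suc j) zero ()
  insertMax-injective [] (y ∷ σ') (suc j) zero e =
    ⊥-elim (fromℕ≢inject₁ {i = y} (proj₁ (∷-injective (proj₂ (∷-injective e)))))
  insertMax-injective (x ∷ σ) σ' (suc j) zero e = ⊥-elim (fromℕ≢inject₁ {i = x} (sym (proj₁ (∷-injective e))))
  insertMax-injective [] [] (suc j) (suc j') e =
    refl , cong suc (trans (sym (length-replicate j))
                           (trans (cong length (proj₂ (∷-injective (proj₂ (∷-injective e))))) (length-replicate j')))
  insertMax-injective [] (y ∷ σ') (suc j) (suc j') e = ⊥-elim (fromℕ≢inject₁ {i = y} (proj₁ (∷-injective e)))
  insertMax-injective (x ∷ σ) [] (suc j) (suc j') e = ⊥-elim (fromℕ≢inject₁ {i = x} (sym (proj₁ (∷-injective e))))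
  insertMax-injective (x ∷ σ) (y ∷ σ') (suc j) (suc j') e
    with refl , refl ← insertMax-injective σ σ' j j' (proj₂ (∷-injective e))
    = cong (_∷ σ) (inject₁-injective (proj₁ (∷-injective e))) , refl

  length-insertMax : ∀ {m} (σ : List (Fin m)) j → j ≤ length σ → length (insertMax σ j) ≡ suc (length σ)
  length-insertMax σ zero _ = cong suc (length-map inject₁ σ)
  length-insertMax (x ∷ σ) (suc j) (s≤s j≤) = cong suc (length-insertMax σ j j≤)

  ∈-insertMax⁻ : ∀ {m} (σ : List (Fin m)) j {z} → j ≤ length σ → z ∈ insertMax σ j →
    z ≡ fromℕ m ⊎ ∃ λ y → y ∈ σ × z ≡ inject₁ y
  ∈-insertMax⁻ σ zero _ (here z≡M) = inj₁ z≡M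
  ∈-insertMax⁻ σ zero _ (there z∈) = inj₂ (∈-map⁻ inject₁ z∈)
  ∈-insertMax⁻ (x ∷ σ) (suc j) _ (here z≡x) = inj₂ (x , here refl , z≡x)
  ∈-insertMax⁻ (x ∷ σ) (suc j) (s≤s j≤) (there z∈) with ∈-insertMax⁻ σ j j≤ z∈
  ... | inj₁ z≡M = inj₁ z≡M
  ... | inj₂ (y , y∈ , z≡y) = inj₂ (y , there y∈ , z≡y)

  insertMax-unique : ∀ {m} (σ : List (Fin m)) j → j ≤ length σ → Unique σ → Unique (insertMax σ j)
  insertMax-unique σ zero _ u =
    All.tabulate (λ z∈ M≡z → let y , _ , z≡y = ∈-map⁻ inject₁ z∈ in fromℕ≢inject₁ {i = y} (trans M≡z z≡y))
    ∷ Unique.map⁺ inject₁-injective u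
  insertMax-unique (x ∷ σ) (suc j) (s≤s j≤) (x∉σ ∷ u) = All.tabulate x≢ ∷ insertMax-unique σ j j≤ u
    where
    x≢ : ∀ {z} → z ∈ insertMax σ j → inject₁ x ≢ z
    x≢ z∈ x≡z with ∈-insertMax⁻ σ j j≤ z∈
    ... | inj₁ z≡M = fromℕ≢inject₁ {i = x} (sym (trans x≡z z≡M))
    ... | inj₂ (y , y∈ , z≡y) = All.lookup x∉σ y∈ (inject₁-injective (trans x≡z z≡y))

  insertMax-++ : ∀ {m} (σ₁ σ₂ : List (Fin m)) →
    insertMax (σ₁ ++ σ₂) (length σ₁) ≡ map inject₁ σ₁ ++ fromℕ m ∷ map inject₁ σ₂
  insertMax-++ [] σ₂ = refl
  insertMax-++ (x ∷ σ₁) σ₂ = cong (inject₁ x ∷_) (insertMax-++ σ₁ σ₂)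

  <ᵇ-true : ∀ a b → a < b → (a <ᵇ b) ≡ true
  <ᵇ-true zero (suc b) _ = refl
  <ᵇ-true (suc a) (suc b) (s≤s a<b) = <ᵇ-true a b a<b

  <ᵇ-false : ∀ a b → b ≤ a → (a <ᵇ b) ≡ false
  <ᵇ-false a zero _ = refl
  <ᵇ-false (suc a) (suc b) (s≤s b≤a) = <ᵇ-false a b b≤a

  index-map-inject₁ : ∀ {m} (σ : List (Fin m)) → index (map inject₁ σ) ≡ index σ
  index-map-inject₁ [] = refl
  index-map-inject₁ (x ∷ []) = refl
  index-map-inject₁ (x ∷ y ∷ σ) = cong₂ _∷_ (cong₂ _<ᵇ_ (toℕ-inject₁ y) (toℕ-inject₁ x)) (index-map-inject₁ (y ∷ σ))

  toℕ-inject₁<toℕ-fromℕ : ∀ {m} (x : Fin m) → toℕ (inject₁ x) < toℕ (fromℕ m)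
  toℕ-inject₁<toℕ-fromℕ {m} x = subst₂ _<_ (sym (toℕ-inject₁ x)) (sym (toℕ-fromℕ m)) (toℕ<n x)

  index-insertMax : ∀ {m} (x : Fin m) σ j → j ≤ length (x ∷ σ) →
    index (insertMax (x ∷ σ) j) ≡ insertMaxIndex j (index (x ∷ σ))
  index-insertMax x σ zero _ =
    cong₂ _∷_ (<ᵇ-true _ _ (toℕ-inject₁<toℕ-fromℕ x)) (index-map-inject₁ (x ∷ σ))
  index-insertMax {m} x [] (suc zero) _ =
    cong (_∷ []) (<ᵇ-false (toℕ (fromℕ m)) (toℕ (inject₁ x)) (<⇒≤ (toℕ-inject₁<toℕ-fromℕ x)))
  index-insertMax {m} x (y ∷ σ) (suc zero) _ =
    cong₂ _∷_ (<ᵇ-false (toℕ (fromℕ m)) (toℕ (inject₁ x)) (<⇒≤ (toℕ-inject₁<toℕ-fromℕ x)))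
              (cong₂ _∷_ (<ᵇ-true _ _ (toℕ-inject₁<toℕ-fromℕ y)) (index-map-inject₁ (y ∷ σ)))
  index-insertMax x [] (suc (suc j)) (s≤s ())
  index-insertMax x (y ∷ σ) (suc (suc j)) (s≤s j<) =
    cong₂ _∷_ (cong₂ _<ᵇ_ (toℕ-inject₁ y) (toℕ-inject₁ x)) (index-insertMax y σ (suc j) j<)

  length-index : ∀ {m} (σ : List (Fin m)) → length (index σ) ≡ length σ ∸ 1
  length-index [] = refl
  length-index (x ∷ []) = refl
  length-index (x ∷ y ∷ σ) = cong suc (length-index (y ∷ σ))

  Unique-lookup-injective : ∀ {A : Set} {xs : List A} → Unique xs → ∀ {i j} → lookup xs i ≡ lookup xs j → i ≡ j
  Unique-lookup-injective {xs = x ∷ xs} u {Fin.zero} {Fin.zero} _ = refl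
  Unique-lookup-injective {xs = x ∷ xs} (x∉ ∷ u) {Fin.zero} {Fin.suc j} e = ⊥-elim (All.lookup x∉ (∈-lookup j) e)
  Unique-lookup-injective {xs = x ∷ xs} (x∉ ∷ u) {Fin.suc i} {Fin.zero} e = ⊥-elim (All.lookup x∉ (∈-lookup i) (sym e))
  Unique-lookup-injective {xs = x ∷ xs} (x∉ ∷ u) {Fin.suc i} {Fin.suc j} e = cong Fin.suc (Unique-lookup-injective u e)

  Unique⇒length≤ : ∀ {n} {xs : List (Fin n)} → Unique xs → length xs ≤ n
  Unique⇒length≤ u = injective⇒≤ (Unique-lookup-injective u)

  lower₁* : ∀ {m} (xs : List (Fin (suc m))) → All (λ z → m ≢ toℕ z) xs → List (Fin m)
  lower₁* [] [] = []
  lower₁* (x ∷ xs) (m≢x ∷ ps) = lower₁ x m≢x ∷ lower₁* xs ps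

  map-inject₁-lower₁* : ∀ {m} (xs : List (Fin (suc m))) ps → map inject₁ (lower₁* xs ps) ≡ xs
  map-inject₁-lower₁* [] [] = refl
  map-inject₁-lower₁* (x ∷ xs) (m≢x ∷ ps) = cong₂ _∷_ (inject₁-lower₁ x m≢x) (map-inject₁-lower₁* xs ps)

  length-lower₁* : ∀ {m} (xs : List (Fin (suc m))) ps → length (lower₁* xs ps) ≡ length xs
  length-lower₁* xs ps = trans (sym (length-map inject₁ (lower₁* xs ps))) (cong length (map-inject₁-lower₁* xs ps))

  Unique-lower₁* : ∀ {m} (xs : List (Fin (suc m))) ps → Unique xs → Unique (lower₁* xs ps)
  Unique-lower₁* xs ps u = Unique.map⁻ (subst Unique (sym (map-inject₁-lower₁* xs ps)) u)

  fromℕ∉⇒≢toℕ : ∀ {m} {xs : List (Fin (suc m))} → fromℕ m ∉ xs → All (λ z → m ≢ toℕ z) xs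
  fromℕ∉⇒≢toℕ {m} {xs} M∉ = All.tabulate (λ {z} z∈ m≡z →
    M∉ (subst (_∈ xs) (toℕ-injective (trans (sym m≡z) (sym (toℕ-fromℕ m)))) z∈))

  -- pigeonhole: otherwise lowering π gives suc m distinct elements of Fin m
  fromℕ-∈ : ∀ {m} (π : List (Fin (suc m))) → length π ≡ suc m → Unique π → fromℕ m ∈ π
  fromℕ-∈ {m} π len u with DecMembership._∈?_ Fin._≟_ (fromℕ m) π
  ... | yes M∈ = M∈
  ... | no M∉ = ⊥-elim (<⇒≱ (n<1+n m) (subst (_≤ m) (trans (length-lower₁* π ps) len)
                                               (Unique⇒length≤ (Unique-lower₁* π ps u))))
    where
    ps : All (λ z → m ≢ toℕ z) π
    ps = fromℕ∉⇒≢toℕ M∉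

  insertions : ∀ m → List (List (Fin (suc m)))
  insertions m = cartesianProductWith insertMax (S m) (upTo (suc m))

  insertions-unique : ∀ m → Unique (insertions m)
  insertions-unique m = Unique.cartesianProductWith⁺ insertMax (insertMax-injective _ _ _ _) (S-unique m) (Unique.upTo⁺ (suc m))

  ∈-insertions⇒∈S : ∀ {m π} → π ∈ insertions m → π ∈ S (suc m)
  ∈-insertions⇒∈S {m} π∈
    with σ , j , σ∈ , j∈ , refl ← ∈-cartesianProductWith⁻ insertMax (S m) (upTo (suc m)) π∈
    with len , u ← ∈S⁻ σ∈ =
    ∈S⁺ (trans (length-insertMax σ j j≤) (cong suc len)) (insertMax-unique σ j j≤ u)
    where
    j≤ : j ≤ length σ
    j≤ = subst (j ≤_) (sym len) (s≤s⁻¹ (∈-upTo⁻ j∈))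

  ∈S⇒∈-insertions : ∀ {m π} → π ∈ S (suc m) → π ∈ insertions m
  ∈S⇒∈-insertions {m} {π} π∈
    with len , u ← ∈S⁻ π∈
    with π₁ , π₂ , refl ← ∈-∃++ (fromℕ-∈ π len u)
    with M∉ ∷ u′ ← Unique-resp-↭ (setoid _) (↭⇒↭ₛ (shift (fromℕ m) π₁ π₂)) u =
    subst (_∈ insertions m) insertMax≡π (∈-cartesianProductWith⁺ insertMax σ∈ j∈)
    where
    ps : All (λ z → m ≢ toℕ z) (π₁ ++ π₂)
    ps = fromℕ∉⇒≢toℕ (λ M∈ → All.lookup M∉ M∈ refl)
    ps₁ : All (λ z → m ≢ toℕ z) π₁
    ps₁ = proj₁ (All.++⁻ π₁ ps)
    ps₂ : All (λ z → m ≢ toℕ z) π₂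
    ps₂ = proj₂ (All.++⁻ π₁ ps)
    σ₁ σ₂ : List (Fin m)
    σ₁ = lower₁* π₁ ps₁
    σ₂ = lower₁* π₂ ps₂
    map-inject₁-σ : map inject₁ (σ₁ ++ σ₂) ≡ π₁ ++ π₂
    map-inject₁-σ =
      trans (map-++ inject₁ σ₁ σ₂) (cong₂ _++_ (map-inject₁-lower₁* π₁ ps₁) (map-inject₁-lower₁* π₂ ps₂))
    insertMax≡π : insertMax (σ₁ ++ σ₂) (length σ₁) ≡ π₁ ++ fromℕ m ∷ π₂
    insertMax≡π = trans (insertMax-++ σ₁ σ₂)
                        (cong₂ (λ a b → a ++ fromℕ m ∷ b) (map-inject₁-lower₁* π₁ ps₁) (map-inject₁-lower₁* π₂ ps₂))
    length-σ : length (σ₁ ++ σ₂) ≡ m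
    length-σ = suc-injective (begin
      suc (length (σ₁ ++ σ₂))
        ≡⟨ cong suc (trans (length-++ σ₁) (cong₂ _+_ (length-lower₁* π₁ ps₁) (length-lower₁* π₂ ps₂))) ⟩
      suc (length π₁ + length π₂)
        ≡⟨ +-suc (length π₁) (length π₂) ⟨
      length π₁ + length (fromℕ m ∷ π₂)
        ≡⟨ length-++ π₁ ⟨
      length (π₁ ++ fromℕ m ∷ π₂)
        ≡⟨ len ⟩
      suc m ∎)
      where open ≡-Reasoning
    σ∈ : σ₁ ++ σ₂ ∈ S m
    σ∈ = ∈S⁺ length-σ (Unique.map⁻ (subst Unique (sym map-inject₁-σ) u′))
    j∈ : length σ₁ ∈ upTo (suc m)
    j∈ = ∈-upTo⁺ (s≤s (subst (length σ₁ ≤_) length-σ (subst (length σ₁ ≤_) (sym (length-++ σ₁)) (m≤m+n _ _))))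

  S-suc↭insertions : ∀ m → S (suc m) ↭ insertions m
  S-suc↭insertions m =
    ∼bag⇒↭ (unique∧set⇒bag (S-unique (suc m)) (insertions-unique m) (mk⇔ ∈S⇒∈-insertions ∈-insertions⇒∈S))

  ΣS : ℕ → (BinStr → ℕ) → ℕ
  ΣS m g = sum (map (g ∘ index) (S m))

  length-index-∈S : ∀ {m} {σ : List (Fin (suc m))} → σ ∈ S (suc m) → length (index σ) ≡ m
  length-index-∈S {σ = σ} σ∈ = trans (length-index σ) (cong (_∸ 1) (proj₁ (∈S⁻ σ∈)))

  ΣS-insertMax : ∀ m g → ΣS (suc (suc m)) g ≡ ΣS (suc m) (λ u → g (true ∷ u) + insertionSum g u)
  ΣS-insertMax m g = begin
    sum (map (g ∘ index) (S (2 + m)))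
      ≡⟨ sum-↭ (Perm.map⁺ (g ∘ index) (S-suc↭insertions (suc m))) ⟩
    sum (map (g ∘ index) (insertions (suc m)))
      ≡⟨ sum-map-cartesianProductWith insertMax (g ∘ index) (S (suc m)) (upTo (2 + m)) ⟩
    sum (map (λ σ → sum (map (g ∘ index ∘ insertMax σ) (upTo (2 + m)))) (S (suc m)))
      ≡⟨ sum-map-cong-∈ (S (suc m)) insertionsOf ⟩
    ΣS (suc m) (λ u → g (true ∷ u) + insertionSum g u) ∎
    where
    open ≡-Reasoning
    insertionsOf : ∀ {σ} → σ ∈ S (suc m) →
      sum (map (g ∘ index ∘ insertMax σ) (upTo (2 + m))) ≡ g (true ∷ index σ) + insertionSum g (index σ)
    insertionsOf {[]} σ∈ with () ← proj₁ (∈S⁻ σ∈)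
    insertionsOf {x ∷ σ} σ∈ = begin
      sum (map (g ∘ index ∘ insertMax (x ∷ σ)) (upTo (2 + m)))
        ≡⟨ sum-map-cong-∈ (upTo (2 + m)) (λ j∈ → cong g (index-insertMax x σ _ (j≤ j∈))) ⟩
      sum (map (λ j → g (insertMaxIndex j (index (x ∷ σ)))) (upTo (2 + m)))
        ≡⟨ sum-map-applyUpTo (λ j → g (insertMaxIndex j (index (x ∷ σ)))) id (2 + m) ⟩
      g (true ∷ index (x ∷ σ)) + sumBelow (λ j → g (insertMaxIndex (suc j) (index (x ∷ σ)))) (suc m)
        ≡⟨ cong (λ n → g (true ∷ index (x ∷ σ)) + sumBelow (λ j → g (insertMaxIndex (suc j) (index (x ∷ σ)))) (suc n))
                (length-index-∈S σ∈) ⟨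
      g (true ∷ index (x ∷ σ)) + insertionSum g (index (x ∷ σ)) ∎
      where
      j≤ : ∀ {j} → j ∈ upTo (2 + m) → j ≤ length (x ∷ σ)
      j≤ {j} j∈ = subst (j ≤_) (sym (proj₁ (∈S⁻ σ∈))) (s≤s⁻¹ (∈-upTo⁻ j∈))

module Recurrence where

  open Sums
  open DescentWords
  open Permutations using (ΣS; ΣS-insertMax; length-index-∈S)
  open import Data.Bool using (true; false; _∧_)
  import Data.Bool as Bool
  open import Data.Bool.Properties using (∧-identityʳ)
  open import Data.Fin using (Fin)
  open import Data.List using (List; _∷_; length; map; filter; upTo)
  open import Data.List.Properties using (map-∘)
  open import Data.List.Membership.Propositional using (_∈_; _∉_)
  open import Data.List.Membership.Propositional.Properties using (∈-map⁺; ∈-filter⁺; ∈-filter⁻; ∈-upTo⁺)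
  open import Data.Nat using (ℕ; suc; _+_; _*_; _∸_; _<_; _≟_; s≤s; z≤n)
  open import Data.Nat.ListAction using (sum)
  open import Data.Nat.Properties using (*-identityˡ; *-zeroʳ; <-trans; n<1+n)
  open import Data.Product using (proj₂)
  open import Function using (_∘_; id)
  open import Relation.Binary.PropositionalEquality using (_≡_; refl; sym; trans; cong; cong₂; subst; module ≡-Reasoning)
  open import Relation.Nullary using (Dec; ¬_; ¬?)
  open import Relation.Nullary.Decidable using (does)

  f≡ΣS : ∀ r m → f r m ≡ ΣS m (χF r)
  f≡ΣS r m = length-filter≡sum (λ π → isF? r (index π)) (S m)

  UD≡ΣS : ∀ r m → UD m r ≡ ΣS m (χUD r)
  UD≡ΣS r m = length-filter≡sum (λ π → isUD? r (index π)) (S m)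

  ΣS-cong-∈ : ∀ {g h} m → (∀ {σ} → σ ∈ S m → g (index σ) ≡ h (index σ)) → ΣS m g ≡ ΣS m h
  ΣS-cong-∈ m g≗h = sum-map-cong-∈ (S m) g≗h

  ΣS-+ : ∀ m g h → ΣS m (λ u → g u + h u) ≡ ΣS m g + ΣS m h
  ΣS-+ m g h = sum-map-+ (g ∘ index) (h ∘ index) (S m)

  ΣS-*ˡ : ∀ m c g → ΣS m (λ u → c * g u) ≡ c * ΣS m g
  ΣS-*ˡ m c g = sum-map-*ˡ c (g ∘ index) (S m)

  ΣS-peakSum≥2 : ∀ m r (H : ℕ → BinStr → ℕ) →
    ΣS m (λ u → peakSum≥2 r (λ p → H p u)) ≡ peakSum≥2 r (λ p → ΣS m (H p))
  ΣS-peakSum≥2 m r H =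
    trans (sum-map-sumBelow (λ i π → 𝟙 (isPeak r (2 + i)) * H (2 + i) (index π)) (length r ∸ 1) (S m))
          (sumBelow-cong (length r ∸ 1) (λ i → ΣS-*ˡ m (𝟙 (isPeak r (2 + i))) (H (2 + i))))

  ΣS-recurrenceBody : ∀ m c r →
    ΣS m (λ u → recurrenceBody (λ s → χF s u) (λ s → χUD s u) c r)
      ≡ recurrenceBody (λ s → ΣS m (χF s)) (λ s → ΣS m (χUD s)) c r
  ΣS-recurrenceBody m c r =
    trans (ΣS-+ m (λ u → 2 * χF r u + c * χUD r u + χUD r′ u) (λ u → peakSum≥2 r (peakTerm (λ s → χF s u) r)))
    (cong₂ _+_
      (trans (ΣS-+ m (λ u → 2 * χF r u + c * χUD r u) (χUD r′))
        (cong (_+ ΣS m (χUD r′))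
          (trans (ΣS-+ m (λ u → 2 * χF r u) (λ u → c * χUD r u))
                 (cong₂ _+_ (ΣS-*ˡ m 2 (χF r)) (ΣS-*ˡ m c (χUD r))))))
      (trans (ΣS-peakSum≥2 m r (λ p u → peakTerm (λ s → χF s u) r p))
             (peakSum≥2-cong r (λ p → ΣS m (λ u → peakTerm (λ s → χF s u) r p)) (peakTerm (λ s → ΣS m (χF s)) r)
               (λ i → ΣS-+ m (χF (del (1 + i) r)) (χF (del (2 + i) r))))))
    where
    r′ : BinStr
    r′ = set1 (length r) r

  f-recurrence : ∀ m a r′ → lastIs0 (a ∷ r′) → let r = a ∷ r′ ; n = suc m in
    f r (suc n) ≡ 𝟙 a * f r′ n + recurrenceBody (λ s → f s n) (UD n) (n ∸ length r) r
  f-recurrence m a r′ last = begin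
    f r (2 + m)
      ≡⟨ f≡ΣS r (2 + m) ⟩
    ΣS (2 + m) (χF r)
      ≡⟨ ΣS-insertMax m (χF r) ⟩
    ΣS (1 + m) (λ u → χF r (true ∷ u) + insertionSum (χF r) u)
      ≡⟨ ΣS-cong-∈ {λ u → χF r (true ∷ u) + insertionSum (χF r) u}
                   {λ u → 𝟙 a * χF r′ u + recurrenceBody (λ s → χF s u) (λ s → χUD s u) c r} (1 + m)
                   (λ {σ} σ∈ → cong₂ _+_ (χF-true∷ a r′ (index σ)) (insertionSum-χF-∈S σ∈)) ⟩
    ΣS (1 + m) (λ u → 𝟙 a * χF r′ u + recurrenceBody (λ s → χF s u) (λ s → χUD s u) c r)
      ≡⟨ ΣS-+ (1 + m) (λ u → 𝟙 a * χF r′ u) (λ u → recurrenceBody (λ s → χF s u) (λ s → χUD s u) c r) ⟩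
    ΣS (1 + m) (λ u → 𝟙 a * χF r′ u) + ΣS (1 + m) (λ u → recurrenceBody (λ s → χF s u) (λ s → χUD s u) c r)
      ≡⟨ cong₂ _+_ (ΣS-*ˡ (1 + m) (𝟙 a) (χF r′)) (ΣS-recurrenceBody (1 + m) c r) ⟩
    𝟙 a * ΣS (1 + m) (χF r′) + recurrenceBody (λ s → ΣS (1 + m) (χF s)) (λ s → ΣS (1 + m) (χUD s)) c r
      ≡⟨ cong₂ _+_ (cong (𝟙 a *_) (f≡ΣS r′ (1 + m)))
                   (recurrenceBody-cong c r (λ s → f≡ΣS s (1 + m)) (λ s → UD≡ΣS s (1 + m))) ⟨
    𝟙 a * f r′ (1 + m) + recurrenceBody (λ s → f s (1 + m)) (UD (1 + m)) c r ∎
    where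
    open ≡-Reasoning
    r : BinStr
    r = a ∷ r′
    c : ℕ
    c = suc m ∸ length r
    insertionSum-χF-∈S : ∀ {σ : List (Fin (suc m))} → σ ∈ S (suc m) →
      insertionSum (χF r) (index σ) ≡ recurrenceBody (λ s → χF s (index σ)) (λ s → χUD s (index σ)) c r
    insertionSum-χF-∈S {σ} σ∈ =
      trans (insertionSum-χF r (index σ) last)
            (cong (λ l → recurrenceBody (λ s → χF s (index σ)) (λ s → χUD s (index σ)) (suc l ∸ length r) r)
                  (length-index-∈S σ∈))

  UD-vanishes : ∀ m r → suc m < length r → UD (suc m) r ≡ 0
  UD-vanishes m r m<r = trans (UD≡ΣS r (suc m)) (sum-map-zero (S (suc m)) short)
    where
    short : ∀ {σ} → σ ∈ S (suc m) → χUD r (index σ) ≡ 0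
    short {σ} σ∈ = χUD-short r (index σ) (subst (_< length r) (sym (length-index-∈S σ∈)) (<-trans (n<1+n m) m<r))

  does-≟-true : ∀ b → does (b Bool.≟ true) ≡ b
  does-≟-true true = refl
  does-≟-true false = refl

  sum-map-K : ∀ a r′ (H : ℕ → ℕ) → sum (map H (K (a ∷ r′))) ≡ 𝟙 a * H 1 + peakSum≥2 (a ∷ r′) H
  sum-map-K a r′ H = begin
    sum (map H (filter isPeak? (map suc (upTo (length r)))))
      ≡⟨ sum-map-filter isPeak? H (map suc (upTo (length r))) ⟩
    sum (map weighted (map suc (upTo (length r))))
      ≡⟨ cong sum (map-∘ (upTo (length r))) ⟨
    sum (map (weighted ∘ suc) (upTo (length r)))
      ≡⟨ sum-map-applyUpTo (weighted ∘ suc) id (length r) ⟩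
    weighted 1 + sumBelow (λ i → weighted (2 + i)) (length r′)
      ≡⟨ cong₂ _+_ (cong (λ b → 𝟙 b * H 1) (trans (does-≟-true (a ∧ true)) (∧-identityʳ a)))
                   (sumBelow-cong (length r′) (λ i → cong (λ b → 𝟙 b * H (2 + i)) (does-≟-true (isPeak r (2 + i))))) ⟩
    𝟙 a * H 1 + peakSum≥2 r H ∎
    where
    open ≡-Reasoning
    r : BinStr
    r = a ∷ r′
    isPeak? : (i : ℕ) → Dec (isPeak r i ≡ true)
    isPeak? i = isPeak r i Bool.≟ true
    weighted : ℕ → ℕ
    weighted i = 𝟙 (does (isPeak? i)) * H i

  sum-map-K-≢1 : ∀ a r′ (H : ℕ → ℕ) →
    sum (map H (filter (λ i → ¬? (i ≟ 1)) (K (a ∷ r′)))) ≡ peakSum≥2 (a ∷ r′) H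
  sum-map-K-≢1 a r′ H = begin
    sum (map H (filter ≢1? (K r)))
      ≡⟨ sum-map-filter ≢1? H (K r) ⟩
    sum (map H′ (K r))
      ≡⟨ sum-map-K a r′ H′ ⟩
    𝟙 a * 0 + peakSum≥2 r H′
      ≡⟨ cong₂ _+_ (*-zeroʳ (𝟙 a)) (peakSum≥2-cong r H′ H (λ i → *-identityˡ (H (2 + i)))) ⟩
    peakSum≥2 r H ∎
    where
    open ≡-Reasoning
    r : BinStr
    r = a ∷ r′
    ≢1? : (i : ℕ) → Dec (¬ (i ≡ 1))
    ≢1? i = ¬? (i ≟ 1)
    H′ : ℕ → ℕ
    H′ i = 𝟙 (does (≢1? i)) * H i

  1∈K-true∷ : ∀ r′ → 1 ∈ K (true ∷ r′)
  1∈K-true∷ r′ =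
    ∈-filter⁺ (λ i → isPeak (true ∷ r′) i Bool.≟ true) (∈-map⁺ suc (∈-upTo⁺ {n = suc (length r′)} (s≤s z≤n))) refl

  1∉K-false∷ : ∀ r′ → 1 ∉ K (false ∷ r′)
  1∉K-false∷ r′ 1∈K
    with () ← proj₂ (∈-filter⁻ (λ i → isPeak (false ∷ r′) i Bool.≟ true) {xs = map suc (upTo (suc (length r′)))} 1∈K)

open DescentWords using (peakSum≥2; peakTerm; recurrenceBody)
open Recurrence using (f-recurrence; UD-vanishes; sum-map-K; sum-map-K-≢1; 1∈K-true∷; 1∉K-false∷)
open import Data.Bool using (true; false)
open import Data.Empty using (⊥-elim)
open import Data.Integer using (ℤ; +_; _+_; _*_; _-_)
import Data.Integer.Properties as ℤ
open import Data.List using ([]; _∷_; map; filter; length)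
open import Data.List.Membership.Propositional using (_∈_; _∉_)
open import Data.Nat using (ℕ; suc; _∸_; _≥_; _≟_; s≤s)
import Data.Nat as ℕ
import Data.Nat.Properties as ℕ
open import Data.Nat.ListAction using (sum)
open import Data.Product using (_×_; _,_)
open import Relation.Binary.PropositionalEquality using (_≡_; refl; sym; trans; cong; cong₂; module ≡-Reasoning)
open import Relation.Nullary using (¬?; yes; no)
open import Algebra.Properties.CommutativeSemigroup ℤ.+-commutativeSemigroup using (x∙yz≈yx∙z)

sumℤ-map-+ : ∀ (g h : ℕ → ℕ) xs → sumℤ (map (λ i → + g i + + h i) xs) ≡ + sum (map (λ i → g i ℕ.+ h i) xs)
sumℤ-map-+ g h [] = refl
sumℤ-map-+ g h (x ∷ xs) = begin
  + g x + + h x + sumℤ (map (λ i → + g i + + h i) xs)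
    ≡⟨ cong₂ _+_ (sym (ℤ.pos-+ (g x) (h x))) (sumℤ-map-+ g h xs) ⟩
  + (g x ℕ.+ h x) + + sum (map (λ i → g i ℕ.+ h i) xs)
    ≡⟨ ℤ.pos-+ (g x ℕ.+ h x) _ ⟨
  + sum (map (λ i → g i ℕ.+ h i) (x ∷ xs)) ∎
  where open ≡-Reasoning

pos-∸-* : ∀ n k u → (n ℕ.< k → u ≡ 0) → + ((n ∸ k) ℕ.* u) ≡ (+ n - + k) * + u
pos-∸-* n k u vanish with k ℕ.≤? n
... | yes k≤n = trans (ℤ.pos-* (n ∸ k) u) (cong (_* + u) (sym (trans (ℤ.m-n≡m⊖n n k) (ℤ.⊖-≥ k≤n))))
... | no k≰n rewrite vanish (ℕ.≰⇒> k≰n) = trans (cong +_ (ℕ.*-zeroʳ (n ∸ k))) (sym (ℤ.*-zeroʳ (+ n - + k)))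

pos-recurrenceBody : ∀ n r F U → (n ℕ.< length r → U r ≡ 0) →
  + recurrenceBody F U (n ∸ length r) r
    ≡ + 2 * + F r + (+ n - + length r) * + U r + + U (set1 (length r) r) + + peakSum≥2 r (peakTerm F r)
pos-recurrenceBody n r F U vanish =
  trans (ℤ.pos-+ _ (peakSum≥2 r (peakTerm F r)))
        (cong (_+ + peakSum≥2 r (peakTerm F r))
          (trans (ℤ.pos-+ _ (U (set1 (length r) r)))
                 (cong (_+ + U (set1 (length r) r))
                   (trans (ℤ.pos-+ (2 ℕ.* F r) _)
                          (cong₂ _+_ (ℤ.pos-* 2 (F r)) (pos-∸-* n (length r) (U r) vanish))))))

proposition4p1 : (r : BinStr) (k n : ℕ) → length r ≡ k → lastIs0 r → n ≥ 2 →
    (1 ∉ K r →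
      + f r (suc n) ≡ + 2 * + f r n + (+ n - + k) * + UD n r + + UD n (set1 k r)
        + sumℤ (map (λ i → + f (del (i ∸ 1) r) n + + f (del i r) n) (K r)))
    × (1 ∈ K r →
      + f r (suc n) ≡ + 2 * + f r n + (+ n - + k) * + UD n r + + UD n (set1 k r)
        + + f (del 1 r) n
        + sumℤ (map (λ i → + f (del (i ∸ 1) r) n + + f (del i r) n)
            (filter (λ i → ¬? (i ≟ 1)) (K r))))
proposition4p1 [] _ _ _ () _
proposition4p1 (false ∷ r′) _ (suc m) refl last (s≤s _) = (λ _ → recurrence) , (λ 1∈K → ⊥-elim (1∉K-false∷ r′ 1∈K))
  where
  open ≡-Reasoning
  r : BinStr
  r = false ∷ r′
  n : ℕ
  n = suc m
  F : BinStr → ℕ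
  F s = f s n
  prefix : ℤ
  prefix = + 2 * + f r n + (+ n - + length r) * + UD n r + + UD n (set1 (length r) r)
  recurrence : + f r (suc n) ≡ prefix + sumℤ (map (λ i → + f (del (i ∸ 1) r) n + + f (del i r) n) (K r))
  recurrence = begin
    + f r (suc n)
      ≡⟨ cong +_ (f-recurrence m false r′ last) ⟩
    + recurrenceBody F (UD n) (n ∸ length r) r
      ≡⟨ pos-recurrenceBody n r F (UD n) (UD-vanishes m r) ⟩
    prefix + + peakSum≥2 r (peakTerm F r)
      ≡⟨ cong (λ x → prefix + x)
              (trans (sumℤ-map-+ (λ i → f (del (i ∸ 1) r) n) (λ i → f (del i r) n) (K r))
                     (cong +_ (sum-map-K false r′ (peakTerm F r)))) ⟨
    prefix + sumℤ (map (λ i → + f (del (i ∸ 1) r) n + + f (del i r) n) (K r)) ∎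
proposition4p1 (true ∷ r′) _ (suc m) refl last (s≤s _) = (λ 1∉K → ⊥-elim (1∉K (1∈K-true∷ r′))) , (λ _ → recurrence)
  where
  open ≡-Reasoning
  r : BinStr
  r = true ∷ r′
  n : ℕ
  n = suc m
  F : BinStr → ℕ
  F s = f s n
  prefix : ℤ
  prefix = + 2 * + f r n + (+ n - + length r) * + UD n r + + UD n (set1 (length r) r)
  recurrence : + f r (suc n) ≡ prefix + + f (del 1 r) n
                 + sumℤ (map (λ i → + f (del (i ∸ 1) r) n + + f (del i r) n) (filter (λ i → ¬? (i ≟ 1)) (K r)))
  recurrence = begin
    + f r (suc n)
      ≡⟨ cong +_ (f-recurrence m true r′ last) ⟩
    + (1 ℕ.* f r′ n ℕ.+ recurrenceBody F (UD n) (n ∸ length r) r)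
      ≡⟨ trans (cong (λ x → + (x ℕ.+ recurrenceBody F (UD n) (n ∸ length r) r)) (ℕ.*-identityˡ (f r′ n)))
               (ℤ.pos-+ (f r′ n) (recurrenceBody F (UD n) (n ∸ length r) r)) ⟩
    + f r′ n + + recurrenceBody F (UD n) (n ∸ length r) r
      ≡⟨ cong (λ x → + f r′ n + x) (pos-recurrenceBody n r F (UD n) (UD-vanishes m r)) ⟩
    + f r′ n + (prefix + + peakSum≥2 r (peakTerm F r))
      ≡⟨ x∙yz≈yx∙z (+ f r′ n) prefix _ ⟩
    prefix + + f r′ n + + peakSum≥2 r (peakTerm F r)
      ≡⟨ cong (λ x → prefix + + f r′ n + x)
              (trans (sumℤ-map-+ (λ i → f (del (i ∸ 1) r) n) (λ i → f (del i r) n) (filter (λ i → ¬? (i ≟ 1)) (K r)))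
                     (cong +_ (sum-map-K-≢1 true r′ (peakTerm F r)))) ⟨
    prefix + + f (del 1 r) n + sumℤ (map (λ i → + f (del (i ∸ 1) r) n + + f (del i r) n) (filter (λ i → ¬? (i ≟ 1)) (K r))) ∎
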